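{- For all non-negative integers $k,\ell,m$ with $k+\ell+m=n$, the number of configurations in $\Omega_n$ having exactly $\ell$ $\times\times$-columns and $k$ black and $m$ white particles in the top row is $$|\Omega^\ell_{k,m}|=\frac{\ell+1}{n+1}\binom{n+1}{k}\binom{n+1}{m}.$$
   Context: $\Omega_n$ is the set of pairs of rows (top and bottom) of $n$ cells each, every cell containing a black, a white, or a neutral ($\times$) particle, such that: a top cell contains $\times$ if and only if the bottom cell of the same column contains $\times$ (so neutral particles form $\times\times$-columns); and each maximal run of consecutive columns without $\times$ (between consecutive $\times\times$-columns or borders; runs may be empty) satisfies balance (as many black as white particles in the run, both rows together) and positivity (every initial segment of columns of the run contains at least as many black as white particles). -}

module Defs where

open import Data.Nat using (ℕ; zero; suc; _+_; _≤ᵇ_; _≡ᵇ_)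
open import Data.Bool using (Bool; true; false; _∧_; not)
open import Data.List using (List; []; _∷_; length; filter; map; concatMap; inits; foldr)
open import Data.Product using (_×_; _,_; proj₁; proj₂)
open import Relation.Nullary.Decidable using (yes; no)
open import Data.Bool.Properties using (T?)

-- Particles: black, white, neutral (×)
data Particle : Set where
  black white neutral : Particle

-- A column: (top cell, bottom cell)
Column : Set
Column = Particle × Particle

-- A configuration of length n, listed column by column from left to right
Config : Set
Config = List Column

isNeutral : Particle → Bool
isNeutral neutral = true
isNeutral _       = false

isBlack : Particle → Bool
isBlack black = true
isBlack _     = false

isWhite : Particle → Bool
isWhite white = true
isWhite _     = false

allB : {A : Set} → (A → Bool) → List A → Bool
allB p [] = true
allB p (x ∷ xs) = p x ∧ allB p xs

b2n : Bool → ℕ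
b2n true  = 1
b2n false = 0

colOK : Column → Bool
colOK (t , b) with isNeutral t | isNeutral b
... | true  | true  = true
... | false | false = true
... | _     | _     = false

isCross : Column → Bool
isCross (t , b) = isNeutral t ∧ isNeutral b

blacks : List Column → ℕ
blacks = foldr (λ c acc → b2n (isBlack (proj₁ c)) + b2n (isBlack (proj₂ c)) + acc) 0

whites : List Column → ℕ
whites = foldr (λ c acc → b2n (isWhite (proj₁ c)) + b2n (isWhite (proj₂ c)) + acc) 0

-- maximal runs of consecutive columns without ××-column, delimited by
-- ××-columns and the borders (possibly empty runs)
runs : List Column → List (List Column)
runs [] = [] ∷ []
runs (c ∷ cs) with isCross c | runs cs
... | true  | rs       = [] ∷ rs
... | false | []       = (c ∷ []) ∷ []
... | false | (r ∷ rs) = (c ∷ r) ∷ rs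

balanced : List Column → Bool
balanced r = blacks r ≡ᵇ whites r

positive : List Column → Bool
positive r = allB (λ p → whites p ≤ᵇ blacks p) (inits r)

-- membership in Ω_n (the length n is imposed by the enumeration below)
inΩ : Config → Bool
inΩ c = allB colOK c ∧ allB (λ r → balanced r ∧ positive r) (runs c)

count : {A : Set} → (A → Bool) → List A → ℕ
count p [] = 0
count p (x ∷ xs) = b2n (p x) + count p xs

crossCols : Config → ℕ
crossCols = count isCross

topBlacks : Config → ℕ
topBlacks = count (λ c → isBlack (proj₁ c))

topWhites : Config → ℕ
topWhites = count (λ c → isWhite (proj₁ c))

particles : List Particle
particles = black ∷ white ∷ neutral ∷ []

allColumns : List Column
allColumns = concatMap (λ t → map (λ b → (t , b)) particles) particles

allConfigs : ℕ → List Config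
allConfigs zero    = [] ∷ []
allConfigs (suc n) = concatMap (λ c → map (c ∷_) (allConfigs n)) allColumns

Ωcount : ℕ → ℕ → ℕ → ℕ → ℕ
Ωcount n ℓ k m =
  count (λ c → inΩ c ∧ (crossCols c ≡ᵇ ℓ) ∧ (topBlacks c ≡ᵇ k) ∧ (topWhites c ≡ᵇ m))
        (allConfigs n)

{-# OPTIONS --safe #-}
-- Read column by column, a configuration lies in Ω exactly when a counter h, half the
-- surplus of black over white particles in the current run, never becomes negative,
-- is raised by bb, lowered by ww, kept by bw and wb, and is 0 at every ××-column and at
-- the end. Counting configurations that start at height h, with m = h + j top whites,
-- gives (n+1)·|Ω| = (h+ℓ+1) C(n+1,k) C(n+1,j). This is proved by induction on n by
-- splitting off the first column: its four contributions recombine into the closed form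
-- through the absorption identities k C(N+1,k) = (N+1) C(N,k-1) and
-- (N+1-k) C(N+1,k) = (N+1) C(N,k).
module Submission where

open import Defs
open import Data.Bool using (Bool; true; false; _∧_; T)
open import Data.Bool.Properties using (∧-zeroʳ)
open import Data.List using (List; []; _∷_; _++_; map; inits; concatMap)
open import Data.List.Properties using (map-cong)
open import Data.Nat using (ℕ; zero; suc; _+_; _*_; _≤_; _<_; _≤ᵇ_; _≡ᵇ_; z≤n; s≤s)
open import Data.Nat.Combinatorics using (_C_; nCk+nC[k+1]≡[n+1]C[k+1]; nC1≡n)
open import Data.Nat.ListAction using (sum)
open import Data.Nat.Properties
  using ( +-assoc; +-comm; +-suc; +-identityʳ; +-cancelʳ-≡; suc-injective; 1+n≢0
        ; *-identityʳ; *-zeroʳ; *-distribˡ-+; *-distribʳ-+; *-cancelˡ-≡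
        ; ≤-trans; ≤-reflexive; n≤1+n; m≤n⇒m≤1+n; <⇒≱; ≡ᵇ⇒≡ )
open import Data.Nat.Tactic.RingSolver using (solve-∀)
open import Data.Product using (Σ-syntax; _,_)
open import Relation.Nullary using (contradiction)
open import Relation.Binary.PropositionalEquality

allB-map : ∀ {A B : Set} (p : B → Bool) (f : A → B) xs → allB p (map f xs) ≡ allB (λ x → p (f x)) xs
allB-map p f []       = refl
allB-map p f (x ∷ xs) = cong (p (f x) ∧_) (allB-map p f xs)

allB-cong : ∀ {A : Set} {p q : A → Bool} → (∀ x → p x ≡ q x) → ∀ xs → allB p xs ≡ allB q xs
allB-cong p≗q []       = refl
allB-cong p≗q (x ∷ xs) = cong₂ _∧_ (p≗q x) (allB-cong p≗q xs)

count-++ : ∀ {A : Set} (p : A → Bool) xs ys → count p (xs ++ ys) ≡ count p xs + count p ys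
count-++ p []       ys = refl
count-++ p (x ∷ xs) ys = trans (cong (b2n (p x) +_) (count-++ p xs ys)) (sym (+-assoc (b2n (p x)) _ _))

count-map : ∀ {A B : Set} (p : B → Bool) (f : A → B) xs → count p (map f xs) ≡ count (λ x → p (f x)) xs
count-map p f []       = refl
count-map p f (x ∷ xs) = cong (b2n (p (f x)) +_) (count-map p f xs)

count-cong : ∀ {A : Set} {p q : A → Bool} → (∀ x → p x ≡ q x) → ∀ xs → count p xs ≡ count q xs
count-cong p≗q []       = refl
count-cong p≗q (x ∷ xs) = cong₂ (λ b n → b2n b + n) (p≗q x) (count-cong p≗q xs)

count-false : ∀ {A : Set} {p : A → Bool} → (∀ x → p x ≡ false) → ∀ xs → count p xs ≡ 0
count-false p≡false []       = refl
count-false p≡false (x ∷ xs) rewrite p≡false x = count-false p≡false xs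

∧-∧-false : ∀ a b → a ∧ b ∧ false ≡ false
∧-∧-false a b = trans (cong (a ∧_) (∧-zeroʳ b)) (∧-zeroʳ a)

∧-∧-∧-false : ∀ a b c → a ∧ b ∧ c ∧ false ≡ false
∧-∧-∧-false a b c = trans (cong (a ∧_) (∧-∧-false b c)) (∧-zeroʳ a)

+-≡ᵇ-cancelˡ : ∀ w x y → (w + x ≡ᵇ w + y) ≡ (x ≡ᵇ y)
+-≡ᵇ-cancelˡ zero    x y = refl
+-≡ᵇ-cancelˡ (suc w) x y = +-≡ᵇ-cancelˡ w x y

+-≤ᵇ-cancelˡ : ∀ w x y → (w + x ≤ᵇ w + y) ≡ (x ≤ᵇ y)
+-≤ᵇ-cancelˡ zero    x y = refl
+-≤ᵇ-cancelˡ (suc w) x y = trans (suc-≤ᵇ (w + x) (w + y)) (+-≤ᵇ-cancelˡ w x y)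
  where
  suc-≤ᵇ : ∀ a b → (suc a ≤ᵇ suc b) ≡ (a ≤ᵇ b)
  suc-≤ᵇ zero    b = refl
  suc-≤ᵇ (suc a) b = refl

infixl 6.5 _C⁻_

_C⁻_ : ℕ → ℕ → ℕ
n C⁻ zero  = 0
n C⁻ suc k = n C k

pascal : ∀ n k → suc n C k ≡ n C k + n C⁻ k
pascal n zero    = refl
pascal n (suc k) = trans (sym (nCk+nC[k+1]≡[n+1]C[k+1] n k)) (+-comm (n C k) (n C suc k))

absorption : ∀ n k → suc k * (suc n C suc k) ≡ suc n * (n C k)
absorption zero    zero    = refl
absorption zero    (suc k) = *-zeroʳ (suc (suc k))
absorption (suc n) zero    = trans (+-identityʳ (suc (suc n) C 1))
  (trans (nC1≡n (suc (suc n))) (sym (*-identityʳ (suc (suc n)))))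
absorption (suc n) (suc k) = begin
  suc (suc k) * (suc (suc n) C suc (suc k))             ≡⟨ cong (suc (suc k) *_) (pascal (suc n) (suc (suc k))) ⟩
  suc (suc k) * (y + x)                                 ≡⟨ regroup k x y ⟩
  suc k * x + suc (suc k) * y + x                       ≡⟨ cong₂ (λ u v → u + v + x) (absorption n k) (absorption n (suc k)) ⟩
  suc n * (n C k) + suc n * (n C suc k) + x             ≡⟨ cong (_+ x) (*-distribˡ-+ (suc n) (n C k) (n C suc k)) ⟨
  suc n * (n C k + n C suc k) + x                       ≡⟨ cong (λ z → suc n * z + x) (nCk+nC[k+1]≡[n+1]C[k+1] n k) ⟩
  suc n * x + x                                         ≡⟨ +-comm (suc n * x) x ⟩
  suc (suc n) * x                                       ∎
  where
  open ≡-Reasoning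
  x = suc n C suc k
  y = suc n C suc (suc k)
  regroup : ∀ k x y → suc (suc k) * (y + x) ≡ suc k * x + suc (suc k) * y + x
  regroup = solve-∀

absorption⁻ : ∀ n k → k * (suc n C k) ≡ suc n * (n C⁻ k)
absorption⁻ n zero    = sym (*-zeroʳ (suc n))
absorption⁻ n (suc k) = absorption n k

absorption-complement : ∀ {n k r} → k + r ≡ n → suc r * (suc n C k) ≡ suc n * (n C k)
absorption-complement {n} {k} {r} refl = +-cancelʳ-≡ (k * (suc n C k)) _ _ (begin
  suc r * (suc n C k) + k * (suc n C k)         ≡⟨ *-distribʳ-+ (suc n C k) (suc r) k ⟨
  (suc r + k) * (suc n C k)                     ≡⟨ cong (_* (suc n C k)) (cong suc (+-comm r k)) ⟩
  suc n * (suc n C k)                           ≡⟨ cong (suc n *_) (pascal n k) ⟩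
  suc n * (n C k + n C⁻ k)                      ≡⟨ *-distribˡ-+ (suc n) (n C k) (n C⁻ k) ⟩
  suc n * (n C k) + suc n * (n C⁻ k)            ≡⟨ cong (suc n * (n C k) +_) (absorption⁻ n k) ⟨
  suc n * (n C k) + k * (suc n C k)             ∎)
  where open ≡-Reasoning

-- With a = C(N,k), a′ = C(N,k-1), b = C(N,j), b′ = C(N,j-1) and s = h + ℓ, the four terms are
-- the closed form applied to the configurations starting with bb, bw, wb, and ww or ××.
columnSum : (s a a′ b b′ : ℕ) → ℕ
columnSum s a a′ b b′ = suc (suc s) * (a′ * b′) + (suc s * (a′ * b) + (suc s * (a * b′) + s * (a * b)))

columnSum-recurrence : ∀ k j s N {a a′ b b′ A B} → k + j + s ≡ N →
  suc N * a ≡ suc (j + s) * A → suc N * a′ ≡ k * A →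
  suc N * b ≡ suc (k + s) * B → suc N * b′ ≡ j * B →
  suc N * (suc N * columnSum s a a′ b b′) ≡ N * (suc N * (suc s * (A * B)))
columnSum-recurrence k j s _ {a} {a′} {b} {b′} {A} {B} refl a≡ a′≡ b≡ b′≡ = begin
  M * (M * columnSum s a a′ b b′)                                  ≡⟨ homogeneous M s a a′ b b′ ⟩
  columnSum s (M * a) (M * a′) (M * b) (M * b′)                    ≡⟨ cong₂ (λ x x′ → columnSum s x x′ (M * b) (M * b′)) a≡ a′≡ ⟩
  columnSum s (suc (j + s) * A) (k * A) (M * b) (M * b′)           ≡⟨ cong₂ (columnSum s (suc (j + s) * A) (k * A)) b≡ b′≡ ⟩
  columnSum s (suc (j + s) * A) (k * A) (suc (k + s) * B) (j * B)  ≡⟨ collect k j s A B ⟩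
  (k + j + s) * (M * (suc s * (A * B)))                            ∎
  where
  open ≡-Reasoning
  M = suc (k + j + s)
  homogeneous : ∀ M s a a′ b b′ →
    M * (M * (suc (suc s) * (a′ * b′) + (suc s * (a′ * b) + (suc s * (a * b′) + s * (a * b)))))
      ≡ suc (suc s) * ((M * a′) * (M * b′)) + (suc s * ((M * a′) * (M * b)) + (suc s * ((M * a) * (M * b′)) + s * ((M * a) * (M * b))))
  homogeneous = solve-∀
  collect : ∀ k j s A B →
    suc (suc s) * ((k * A) * (j * B)) + (suc s * ((k * A) * (suc (k + s) * B))
      + (suc s * ((suc (j + s) * A) * (j * B)) + s * ((suc (j + s) * A) * (suc (k + s) * B))))
      ≡ (k + j + s) * (suc (k + j + s) * (suc s * (A * B)))
  collect = solve-∀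

columnSum-binomial : ∀ k j s N → k + j + s ≡ N →
  suc N * (suc N * columnSum s (N C k) (N C⁻ k) (N C j) (N C⁻ j)) ≡ N * (suc N * (suc s * ((suc N C k) * (suc N C j))))
columnSum-binomial k j s N total =
  columnSum-recurrence k j s N {N C k} {N C⁻ k} {N C j} {N C⁻ j} {suc N C k} {suc N C j} total
  (sym (absorption-complement {N} {k} {j + s} (trans (sym (+-assoc k j s)) total)))
  (sym (absorption⁻ N k))
  (sym (absorption-complement {N} {j} {k + s} (trans (sym (+-assoc j k s)) (trans (cong (_+ s) (+-comm j k)) total))))
  (sym (absorption⁻ N j))

validFrom : ℕ → Config → Bool
validFrom h       []                         = h ≡ᵇ 0
validFrom h       ((black , black) ∷ cs)     = validFrom (suc h) cs
validFrom h       ((black , white) ∷ cs)     = validFrom h cs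
validFrom h       ((white , black) ∷ cs)     = validFrom h cs
validFrom (suc h) ((white , white) ∷ cs)     = validFrom h cs
validFrom h       ((neutral , neutral) ∷ cs) = (h ≡ᵇ 0) ∧ validFrom 0 cs
validFrom _       _                          = false

runs-nonempty : ∀ cs → Σ[ r ∈ Config ] Σ[ rs ∈ List Config ] runs cs ≡ r ∷ rs
runs-nonempty []       = [] , [] , refl
runs-nonempty (c ∷ cs) with isCross c | runs cs | runs-nonempty cs
... | true  | rs     | _         = [] , rs , refl
... | false | r ∷ rs | _         = c ∷ r , rs , refl
... | false | []     | _ , _ , ()

runs-∷-nonCross : ∀ {r rs} c cs → isCross c ≡ false → runs cs ≡ r ∷ rs → runs (c ∷ cs) ≡ (c ∷ r) ∷ rs
runs-∷-nonCross c cs nonCross split rewrite nonCross | split = refl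

-- The conditions defining Ω, for a first run that starts with a surplus of d black particles.
balancedFrom positiveFrom : ℕ → List Column → Bool
balancedFrom d r = (d + blacks r) ≡ᵇ whites r
positiveFrom d r = allB (λ p → whites p ≤ᵇ d + blacks p) (inits r)

goodRun : List Column → Bool
goodRun r = balanced r ∧ positive r

firstRunFrom : ℕ → List (List Column) → Bool
firstRunFrom d []       = true
firstRunFrom d (r ∷ rs) = (balancedFrom d r ∧ positiveFrom d r) ∧ allB goodRun rs

ΩFrom : ℕ → Config → Bool
ΩFrom d cs = allB colOK cs ∧ firstRunFrom d (runs cs)

inΩ≡ΩFrom0 : ∀ cs → inΩ cs ≡ ΩFrom 0 cs
inΩ≡ΩFrom0 cs = cong (allB colOK cs ∧_) (allRuns≡firstRunFrom0 (runs cs))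
  where
  allRuns≡firstRunFrom0 : ∀ rs → allB goodRun rs ≡ firstRunFrom 0 rs
  allRuns≡firstRunFrom0 []       = refl
  allRuns≡firstRunFrom0 (r ∷ rs) = refl

columnBlacks columnWhites : Column → ℕ
columnBlacks (t , b) = b2n (isBlack t) + b2n (isBlack b)
columnWhites (t , b) = b2n (isWhite t) + b2n (isWhite b)

module _ (c : Column) (nonCross : isCross c ≡ false) (ok : colOK c ≡ true) {d d′ : ℕ}
         (surplus : columnBlacks c + d ≡ columnWhites c + d′) where

  private
    shift : ∀ r → d + blacks (c ∷ r) ≡ columnWhites c + (d′ + blacks r)
    shift r = begin
      d + (columnBlacks c + blacks r)  ≡⟨ +-assoc d (columnBlacks c) (blacks r) ⟨
      d + columnBlacks c + blacks r    ≡⟨ cong (_+ blacks r) (+-comm d (columnBlacks c)) ⟩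
      columnBlacks c + d + blacks r    ≡⟨ cong (_+ blacks r) surplus ⟩
      columnWhites c + d′ + blacks r   ≡⟨ +-assoc (columnWhites c) d′ (blacks r) ⟩
      columnWhites c + (d′ + blacks r) ∎
      where open ≡-Reasoning

  balancedFrom-∷ : ∀ r → balancedFrom d (c ∷ r) ≡ balancedFrom d′ r
  balancedFrom-∷ r = trans (cong (_≡ᵇ whites (c ∷ r)) (shift r)) (+-≡ᵇ-cancelˡ (columnWhites c) _ _)

  positiveFrom-∷ : ∀ r → positiveFrom d (c ∷ r) ≡ positiveFrom d′ r
  positiveFrom-∷ r = trans (allB-map _ (c ∷_) (inits r))
    (allB-cong (λ p → trans (cong (whites (c ∷ p) ≤ᵇ_) (shift p)) (+-≤ᵇ-cancelˡ (columnWhites c) _ _)) (inits r))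

  ΩFrom-∷-nonCross : ∀ cs → ΩFrom d (c ∷ cs) ≡ ΩFrom d′ cs
  ΩFrom-∷-nonCross cs with runs-nonempty cs
  ... | r , rs , split = begin
    (colOK c ∧ allB colOK cs) ∧ firstRunFrom d (runs (c ∷ cs))
      ≡⟨ cong₂ (λ x y → (x ∧ allB colOK cs) ∧ firstRunFrom d y) ok (runs-∷-nonCross c cs nonCross split) ⟩
    allB colOK cs ∧ ((balancedFrom d (c ∷ r) ∧ positiveFrom d (c ∷ r)) ∧ rest)
      ≡⟨ cong₂ (λ x y → allB colOK cs ∧ ((x ∧ y) ∧ rest)) (balancedFrom-∷ r) (positiveFrom-∷ r) ⟩
    allB colOK cs ∧ ((balancedFrom d′ r ∧ positiveFrom d′ r) ∧ rest)
      ≡⟨ cong (λ y → allB colOK cs ∧ firstRunFrom d′ y) split ⟨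
    ΩFrom d′ cs ∎
    where
    open ≡-Reasoning
    rest = allB goodRun rs

double : ℕ → ℕ
double zero    = zero
double (suc h) = suc (suc (double h))

ΩFrom-double≡validFrom : ∀ h cs → ΩFrom (double h) cs ≡ validFrom h cs
ΩFrom-double≡validFrom zero    []                         = refl
ΩFrom-double≡validFrom (suc h) []                         = refl
ΩFrom-double≡validFrom h       ((black , black) ∷ cs)     =
  trans (ΩFrom-∷-nonCross (black , black) refl refl refl cs) (ΩFrom-double≡validFrom (suc h) cs)
ΩFrom-double≡validFrom h       ((black , white) ∷ cs)     =
  trans (ΩFrom-∷-nonCross (black , white) refl refl refl cs) (ΩFrom-double≡validFrom h cs)
ΩFrom-double≡validFrom h       ((white , black) ∷ cs)     =
  trans (ΩFrom-∷-nonCross (white , black) refl refl refl cs) (ΩFrom-double≡validFrom h cs)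
ΩFrom-double≡validFrom (suc h) ((white , white) ∷ cs)     =
  trans (ΩFrom-∷-nonCross (white , white) refl refl refl cs) (ΩFrom-double≡validFrom h cs)
ΩFrom-double≡validFrom zero    ((white , white) ∷ cs)     with runs-nonempty cs
... | r , rs , split = begin
  allB colOK cs ∧ firstRunFrom 0 (runs ((white , white) ∷ cs))
    ≡⟨ cong (λ y → allB colOK cs ∧ firstRunFrom 0 y) (runs-∷-nonCross (white , white) cs refl split) ⟩
  allB colOK cs ∧ ((balancedFrom 0 ((white , white) ∷ r) ∧ false) ∧ allB goodRun rs)
    ≡⟨ cong (λ x → allB colOK cs ∧ (x ∧ allB goodRun rs)) (∧-zeroʳ (balancedFrom 0 ((white , white) ∷ r))) ⟩
  allB colOK cs ∧ false
    ≡⟨ ∧-zeroʳ (allB colOK cs) ⟩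
  false ∎
  where open ≡-Reasoning
ΩFrom-double≡validFrom zero    ((neutral , neutral) ∷ cs) =
  trans (inΩ≡ΩFrom0 cs) (ΩFrom-double≡validFrom zero cs)
ΩFrom-double≡validFrom (suc h) ((neutral , neutral) ∷ cs) = ∧-zeroʳ (allB colOK cs)
ΩFrom-double≡validFrom h       ((black , neutral) ∷ cs)   = refl
ΩFrom-double≡validFrom h       ((white , neutral) ∷ cs)   = refl
ΩFrom-double≡validFrom h       ((neutral , black) ∷ cs)   = refl
ΩFrom-double≡validFrom h       ((neutral , white) ∷ cs)   = refl

inΩ≡validFrom0 : ∀ cs → inΩ cs ≡ validFrom 0 cs
inΩ≡validFrom0 cs = trans (inΩ≡ΩFrom0 cs) (ΩFrom-double≡validFrom 0 cs)

count-allConfigs-suc : ∀ (p : Config → Bool) n →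
  count p (allConfigs (suc n)) ≡ sum (map (λ c → count (λ cs → p (c ∷ cs)) (allConfigs n)) allColumns)
count-allConfigs-suc p n = go allColumns
  where
  go : ∀ cols → count p (concatMap (λ c → map (c ∷_) (allConfigs n)) cols)
              ≡ sum (map (λ c → count (λ cs → p (c ∷ cs)) (allConfigs n)) cols)
  go []         = refl
  go (c ∷ cols) = trans (count-++ p (map (c ∷_) (allConfigs n)) _)
                        (cong₂ _+_ (count-map p (c ∷_) (allConfigs n)) (go cols))

Counted : (h ℓ k m : ℕ) → Config → Bool
Counted h ℓ k m cs = validFrom h cs ∧ (crossCols cs ≡ᵇ ℓ) ∧ (topBlacks cs ≡ᵇ k) ∧ (topWhites cs ≡ᵇ m)

ΩcountFrom : (n h ℓ k m : ℕ) → ℕ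
ΩcountFrom n h ℓ k m = count (Counted h ℓ k m) (allConfigs n)

Ωcount≡ΩcountFrom0 : ∀ n ℓ k m → Ωcount n ℓ k m ≡ ΩcountFrom n 0 ℓ k m
Ωcount≡ΩcountFrom0 n ℓ k m =
  count-cong (λ cs → cong (_∧ ((crossCols cs ≡ᵇ ℓ) ∧ (topBlacks cs ≡ᵇ k) ∧ (topWhites cs ≡ᵇ m))) (inΩ≡validFrom0 cs))
             (allConfigs n)

ΩcountAfter : Column → (n h ℓ k m : ℕ) → ℕ
ΩcountAfter (black , black)     n h       ℓ       (suc k) m       = ΩcountFrom n (suc h) ℓ k m
ΩcountAfter (black , white)     n h       ℓ       (suc k) m       = ΩcountFrom n h ℓ k m
ΩcountAfter (white , black)     n h       ℓ       k       (suc m) = ΩcountFrom n h ℓ k m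
ΩcountAfter (white , white)     n (suc h) ℓ       k       (suc m) = ΩcountFrom n h ℓ k m
ΩcountAfter (neutral , neutral) n zero    (suc ℓ) k       m       = ΩcountFrom n zero ℓ k m
ΩcountAfter _                   _ _       _       _       _       = 0

count-Counted-∷ : ∀ c n h ℓ k m → count (λ cs → Counted h ℓ k m (c ∷ cs)) (allConfigs n) ≡ ΩcountAfter c n h ℓ k m
count-Counted-∷ (black , black) n h ℓ zero m =
  count-false (λ cs → ∧-∧-false (validFrom (suc h) cs) (crossCols cs ≡ᵇ ℓ)) (allConfigs n)
count-Counted-∷ (black , black) n h ℓ (suc k) m = refl
count-Counted-∷ (black , white) n h ℓ zero m =
  count-false (λ cs → ∧-∧-false (validFrom h cs) (crossCols cs ≡ᵇ ℓ)) (allConfigs n)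
count-Counted-∷ (black , white) n h ℓ (suc k) m = refl
count-Counted-∷ (white , black) n h ℓ k zero =
  count-false (λ cs → ∧-∧-∧-false (validFrom h cs) (crossCols cs ≡ᵇ ℓ) (topBlacks cs ≡ᵇ k)) (allConfigs n)
count-Counted-∷ (white , black) n h ℓ k (suc m) = refl
count-Counted-∷ (white , white) n zero ℓ k m = count-false (λ _ → refl) (allConfigs n)
count-Counted-∷ (white , white) n (suc h) ℓ k zero =
  count-false (λ cs → ∧-∧-∧-false (validFrom h cs) (crossCols cs ≡ᵇ ℓ) (topBlacks cs ≡ᵇ k)) (allConfigs n)
count-Counted-∷ (white , white) n (suc h) ℓ k (suc m) = refl
count-Counted-∷ (neutral , neutral) n zero zero k m = count-false (λ cs → ∧-zeroʳ (validFrom 0 cs)) (allConfigs n)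
count-Counted-∷ (neutral , neutral) n zero (suc ℓ) k m = refl
count-Counted-∷ (neutral , neutral) n (suc h) ℓ k m = count-false (λ _ → refl) (allConfigs n)
count-Counted-∷ (black , neutral) n h ℓ k m = count-false (λ _ → refl) (allConfigs n)
count-Counted-∷ (white , neutral) n h ℓ k m = count-false (λ _ → refl) (allConfigs n)
count-Counted-∷ (neutral , black) n h ℓ k m = count-false (λ _ → refl) (allConfigs n)
count-Counted-∷ (neutral , white) n h ℓ k m = count-false (λ _ → refl) (allConfigs n)

ΩcountFrom-suc : ∀ n h ℓ k m →
  ΩcountFrom (suc n) h ℓ k m ≡ sum (map (λ c → ΩcountAfter c n h ℓ k m) allColumns)
ΩcountFrom-suc n h ℓ k m = trans (count-allConfigs-suc (Counted h ℓ k m) n)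
  (cong sum (map-cong (λ c → count-Counted-∷ c n h ℓ k m) allColumns))

validFrom⇒≤topWhites : ∀ h cs → validFrom h cs ≡ true → h ≤ topWhites cs
validFrom⇒≤topWhites zero    []                         _     = z≤n
validFrom⇒≤topWhites h       ((black , black) ∷ cs)     valid =
  ≤-trans (n≤1+n h) (validFrom⇒≤topWhites (suc h) cs valid)
validFrom⇒≤topWhites h       ((black , white) ∷ cs)     valid = validFrom⇒≤topWhites h cs valid
validFrom⇒≤topWhites h       ((white , black) ∷ cs)     valid = m≤n⇒m≤1+n (validFrom⇒≤topWhites h cs valid)
validFrom⇒≤topWhites (suc h) ((white , white) ∷ cs)     valid = s≤s (validFrom⇒≤topWhites h cs valid)
validFrom⇒≤topWhites zero    ((neutral , neutral) ∷ cs) _     = z≤n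
validFrom⇒≤topWhites (suc h) ((neutral , neutral) ∷ cs) ()

ΩcountFrom-vanishes : ∀ n {h ℓ k m} → m < h → ΩcountFrom n h ℓ k m ≡ 0
ΩcountFrom-vanishes n {h} {ℓ} {k} {m} m<h = count-false rejects (allConfigs n)
  where
  rejects : ∀ cs → validFrom h cs ∧ (crossCols cs ≡ᵇ ℓ) ∧ (topBlacks cs ≡ᵇ k) ∧ (topWhites cs ≡ᵇ m) ≡ false
  rejects cs with validFrom h cs in valid | topWhites cs ≡ᵇ m in whites≡m
  ... | false | _     = refl
  ... | true  | false = ∧-∧-false (crossCols cs ≡ᵇ ℓ) (topBlacks cs ≡ᵇ k)
  ... | true  | true  = contradiction
    (≤-trans (validFrom⇒≤topWhites h cs valid) (≤-reflexive (≡ᵇ⇒≡ (topWhites cs) m (subst T (sym whites≡m) _))))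
    (<⇒≱ m<h)

ClosedForm : ℕ → Set
ClosedForm n = ∀ {h ℓ k m} j → h + j ≡ m → k + ℓ + m ≡ n →
  suc n * ΩcountFrom n h ℓ k m ≡ suc (h + ℓ) * ((suc n C k) * (suc n C j))

module FirstColumn (n : ℕ) (closedForm : ClosedForm n) where

  private
    N = suc n

    vanishing : ∀ {x y} c → x ≡ 0 → y ≡ 0 → N * x ≡ c * y
    vanishing c refl refl = trans (*-zeroʳ N) (sym (*-zeroʳ c))

  bb-term : ∀ {h ℓ k m} j → h + j ≡ m → k + ℓ + m ≡ N →
    N * ΩcountAfter (black , black) n h ℓ k m ≡ suc (suc (h + ℓ)) * ((N C⁻ k) * (N C⁻ j))
  bb-term {h} {ℓ} {zero}  j       _     _     = vanishing (suc (suc (h + ℓ))) refl refl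
  bb-term {h} {ℓ} {suc k} zero    h+0≡m _     =
    vanishing (suc (suc (h + ℓ))) (ΩcountFrom-vanishes n (s≤s (≤-reflexive (trans (sym h+0≡m) (+-identityʳ h))))) (*-zeroʳ (N C k))
  bb-term {h} {ℓ} {suc k} (suc j) hj    total = closedForm j (trans (sym (+-suc h j)) hj) (suc-injective total)

  bw-term : ∀ {h ℓ k m} j → h + j ≡ m → k + ℓ + m ≡ N →
    N * ΩcountAfter (black , white) n h ℓ k m ≡ suc (h + ℓ) * ((N C⁻ k) * (N C j))
  bw-term {h} {ℓ} {zero}  j _  _     = vanishing (suc (h + ℓ)) refl refl
  bw-term {h} {ℓ} {suc k} j hj total = closedForm j hj (suc-injective total)

  wb-term : ∀ {h ℓ k m} j → h + j ≡ m → k + ℓ + m ≡ N →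
    N * ΩcountAfter (white , black) n h ℓ k m ≡ suc (h + ℓ) * ((N C k) * (N C⁻ j))
  wb-term {h} {ℓ} {k} {zero}  zero    _        _     = vanishing (suc (h + ℓ)) refl (*-zeroʳ (N C k))
  wb-term {h} {ℓ} {k} {suc m} zero    h+0≡1+m  _     =
    vanishing (suc (h + ℓ)) (ΩcountFrom-vanishes n (≤-reflexive (trans (sym h+0≡1+m) (+-identityʳ h))))
      (*-zeroʳ (N C k))
  wb-term {h} {ℓ} {k} {zero}  (suc j) hj       _     = contradiction (trans (sym (+-suc h j)) hj) 1+n≢0
  wb-term {h} {ℓ} {k} {suc m} (suc j) hj       total =
    closedForm j (suc-injective (trans (sym (+-suc h j)) hj)) (suc-injective (trans (sym (+-suc (k + ℓ) m)) total))

  down-term : ∀ {h ℓ k m} j → h + j ≡ m → k + ℓ + m ≡ N →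
    N * (ΩcountAfter (white , white) n h ℓ k m + ΩcountAfter (neutral , neutral) n h ℓ k m)
      ≡ (h + ℓ) * ((N C k) * (N C j))
  down-term {zero}  {zero}        j _  _     = *-zeroʳ N
  down-term {zero}  {suc ℓ} {k} {m} j hj total =
    closedForm j hj (suc-injective (trans (cong (_+ m) (sym (+-suc k ℓ))) total))
  down-term {suc h} {m = zero}    j () _
  down-term {suc h} {ℓ} {k} {suc m} j hj total =
    trans (cong (N *_) (+-identityʳ _)) (closedForm j (suc-injective hj) (suc-injective (trans (sym (+-suc (k + ℓ) m)) total)))

  ΩcountFrom-suc-columnSum : ∀ {h ℓ k m} j → h + j ≡ m → k + ℓ + m ≡ N →
    N * ΩcountFrom N h ℓ k m ≡ columnSum (h + ℓ) (N C k) (N C⁻ k) (N C j) (N C⁻ j)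
  ΩcountFrom-suc-columnSum {h} {ℓ} {k} {m} j hj total = begin
    N * ΩcountFrom N h ℓ k m
      ≡⟨ cong (N *_) (ΩcountFrom-suc n h ℓ k m) ⟩
    N * (after (black , black) + (after (black , white) + (after (white , black)
      + (after (white , white) + (after (neutral , neutral) + 0)))))
      ≡⟨ distribute N (after (black , black)) (after (black , white)) (after (white , black))
                    (after (white , white)) (after (neutral , neutral)) ⟩
    N * after (black , black) + (N * after (black , white) + (N * after (white , black)
      + N * (after (white , white) + after (neutral , neutral))))
      ≡⟨ cong₂ _+_ (bb-term {h} {ℓ} {k} j hj total) (cong₂ _+_ (bw-term {h} {ℓ} {k} j hj total)
          (cong₂ _+_ (wb-term {h} {ℓ} {k} j hj total) (down-term {h} {ℓ} {k} j hj total))) ⟩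
    columnSum (h + ℓ) (N C k) (N C⁻ k) (N C j) (N C⁻ j) ∎
    where
    open ≡-Reasoning
    after : Column → ℕ
    after c = ΩcountAfter c n h ℓ k m
    distribute : ∀ N a b c d e → N * (a + (b + (c + (d + (e + 0))))) ≡ N * a + (N * b + (N * c + N * (d + e)))
    distribute = solve-∀

ΩcountFrom-closedForm : ∀ n → ClosedForm n
ΩcountFrom-closedForm zero {zero} {zero} {zero} {zero} zero refl refl = refl
ΩcountFrom-closedForm (suc n) {h} {ℓ} {k} {m} j hj total =
  *-cancelˡ-≡ _ _ (suc N) (*-cancelˡ-≡ _ _ N (begin
    N * (suc N * (suc N * ΩcountFrom N h ℓ k m))
      ≡⟨ reorder N (suc N) (ΩcountFrom N h ℓ k m) ⟩
    suc N * (suc N * (N * ΩcountFrom N h ℓ k m))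
      ≡⟨ cong (λ x → suc N * (suc N * x)) (ΩcountFrom-suc-columnSum j hj total) ⟩
    suc N * (suc N * columnSum (h + ℓ) (N C k) (N C⁻ k) (N C j) (N C⁻ j))
      ≡⟨ columnSum-binomial k j (h + ℓ) N (trans (regroup k j h ℓ) (trans (cong (k + ℓ +_) hj) total)) ⟩
    N * (suc N * (suc (h + ℓ) * ((suc N C k) * (suc N C j)))) ∎))
  where
  open ≡-Reasoning
  open FirstColumn n (ΩcountFrom-closedForm n)
  N = suc n
  reorder : ∀ a b x → a * (b * (b * x)) ≡ b * (b * (a * x))
  reorder = solve-∀
  regroup : ∀ k j h ℓ → k + j + (h + ℓ) ≡ k + ℓ + (h + j)
  regroup = solve-∀

lemma5 : (n k ℓ m : ℕ) → k + ℓ + m ≡ n →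
    suc n * Ωcount n ℓ k m ≡ suc ℓ * ((suc n C k) * (suc n C m))
lemma5 n k ℓ m total = trans (cong (suc n *_) (Ωcount≡ΩcountFrom0 n ℓ k m)) (ΩcountFrom-closedForm n m refl total)
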